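{- Let $\mathsf{BA}$ and $\mathsf{SL}$ be the subvarieties of $V(\mathsf{BCA})$ axiomatised relative to $V(\mathsf{BCA})$ by $J_2x\approx x$ and $J_2x\approx1$, respectively. Then their join in the lattice of subvarieties of $V(\mathsf{BCA})$ equals their direct product: $\mathsf{BA}\vee\mathsf{SL}=\mathsf{BA}\times\mathsf{SL}$, where $\mathsf{BA}\times\mathsf{SL}$ is the class of all algebras isomorphic to $\mathbf{A}_1\times\mathbf{A}_2$ with $\mathbf{A}_1\in\mathsf{BA}$, $\mathbf{A}_2\in\mathsf{SL}$.
   Context: $\mathbf{WK}^e$ is the algebra on $\{0,\tfrac12,1\}$ of type $\langle\wedge,\vee,\neg,J_2,0,1\rangle$ with $\neg0=1,\neg\tfrac12=\tfrac12,\neg1=0$; $\vee,\wedge$ Boolean on $\{0,1\}$ and outputting $\tfrac12$ whenever an argument is $\tfrac12$; $J_21=1$, $J_2\tfrac12=J_20=0$. $\mathsf{BCA}=ISP(\mathbf{WK}^e)$ and $V(\mathsf{BCA})$ is the variety it generates. -}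

module Defs where

open import Level using (Level; _⊔_) renaming (suc to lsuc)
open import Data.Nat using (ℕ)
open import Data.Product using (_×_; _,_; Σ; ∃)
open import Relation.Binary.Core using (Rel)
open import Relation.Binary.Structures using (IsEquivalence)
open import Relation.Binary.PropositionalEquality using (_≡_)

-- The three-element algebra WK^e of type ⟨∧,∨,¬,J₂,0,1⟩

data 𝟛 : Set where
  𝟎 ½ 𝟏 : 𝟛

¬₃ : 𝟛 → 𝟛
¬₃ 𝟎 = 𝟏
¬₃ ½ = ½
¬₃ 𝟏 = 𝟎

_∧₃_ : 𝟛 → 𝟛 → 𝟛
½ ∧₃ _ = ½
_ ∧₃ ½ = ½
𝟎 ∧₃ _ = 𝟎
𝟏 ∧₃ y = y

_∨₃_ : 𝟛 → 𝟛 → 𝟛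
½ ∨₃ _ = ½
_ ∨₃ ½ = ½
𝟏 ∨₃ _ = 𝟏
𝟎 ∨₃ y = y

J₂₃ : 𝟛 → 𝟛
J₂₃ 𝟏 = 𝟏
J₂₃ ½ = 𝟎
J₂₃ 𝟎 = 𝟎

record Alg (c ℓ : Level) : Set (lsuc (c ⊔ ℓ)) where
  field
    Carrier : Set c
    _≈_     : Rel Carrier ℓ
    isEquivalence : IsEquivalence _≈_
    _∧_ _∨_ : Carrier → Carrier → Carrier
    ¬_ J₂   : Carrier → Carrier
    zero one : Carrier
    ∧-cong : ∀ {x x' y y'} → x ≈ x' → y ≈ y' → (x ∧ y) ≈ (x' ∧ y')
    ∨-cong : ∀ {x x' y y'} → x ≈ x' → y ≈ y' → (x ∨ y) ≈ (x' ∨ y')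
    ¬-cong : ∀ {x x'} → x ≈ x' → (¬ x) ≈ (¬ x')
    J₂-cong : ∀ {x x'} → x ≈ x' → J₂ x ≈ J₂ x'

data Term : Set where
  var : ℕ → Term
  _∧ₜ_ _∨ₜ_ : Term → Term → Term
  ¬ₜ_ J₂ₜ : Term → Term
  0ₜ 1ₜ : Term

module _ {c ℓ} (A : Alg c ℓ) where
  open Alg A

  ⟦_⟧ : Term → (ℕ → Carrier) → Carrier
  ⟦ var i ⟧ ρ = ρ i
  ⟦ s ∧ₜ t ⟧ ρ = (⟦ s ⟧ ρ) ∧ (⟦ t ⟧ ρ)
  ⟦ s ∨ₜ t ⟧ ρ = (⟦ s ⟧ ρ) ∨ (⟦ t ⟧ ρ)
  ⟦ ¬ₜ s ⟧ ρ = ¬ (⟦ s ⟧ ρ)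
  ⟦ J₂ₜ s ⟧ ρ = J₂ (⟦ s ⟧ ρ)
  ⟦ 0ₜ ⟧ ρ = zero
  ⟦ 1ₜ ⟧ ρ = one

  Sat : Term → Term → Set (c ⊔ ℓ)
  Sat s t = ∀ (ρ : ℕ → Carrier) → (⟦ s ⟧ ρ) ≈ (⟦ t ⟧ ρ)

⟦_⟧₃ : Term → (ℕ → 𝟛) → 𝟛
⟦ var i ⟧₃ ρ = ρ i
⟦ s ∧ₜ t ⟧₃ ρ = (⟦ s ⟧₃ ρ) ∧₃ (⟦ t ⟧₃ ρ)
⟦ s ∨ₜ t ⟧₃ ρ = (⟦ s ⟧₃ ρ) ∨₃ (⟦ t ⟧₃ ρ)
⟦ ¬ₜ s ⟧₃ ρ = ¬₃ (⟦ s ⟧₃ ρ)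
⟦ J₂ₜ s ⟧₃ ρ = J₂₃ (⟦ s ⟧₃ ρ)
⟦ 0ₜ ⟧₃ ρ = 𝟎
⟦ 1ₜ ⟧₃ ρ = 𝟏

SatWK : Term → Term → Set
SatWK s t = ∀ (ρ : ℕ → 𝟛) → ⟦ s ⟧₃ ρ ≡ ⟦ t ⟧₃ ρ

-- V(BCA) = V(WK^e) = Mod(Id(WK^e))  (Birkhoff HSP theorem)
InVBCA : ∀ {c ℓ} → Alg c ℓ → Set (c ⊔ ℓ)
InVBCA A = ∀ s t → SatWK s t → Sat A s t

InBA : ∀ {c ℓ} → Alg c ℓ → Set (c ⊔ ℓ)
InBA A = InVBCA A × Sat A (J₂ₜ (var 0)) (var 0)

InSL : ∀ {c ℓ} → Alg c ℓ → Set (c ⊔ ℓ)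
InSL A = InVBCA A × Sat A (J₂ₜ (var 0)) 1ₜ

-- BA ∨ SL: the least subvariety containing BA and SL,
-- i.e. Mod(Id(BA) ∩ Id(SL)), identities computed over algebras of level (c,ℓ)
InJoin : ∀ {c ℓ} → Alg c ℓ → Set (lsuc (c ⊔ ℓ))
InJoin {c} {ℓ} A =
  ∀ s t → (∀ (B : Alg c ℓ) → InBA B → Sat B s t)
        → (∀ (B : Alg c ℓ) → InSL B → Sat B s t)
        → Sat A s t

_⊗_ : ∀ {c ℓ} → Alg c ℓ → Alg c ℓ → Alg c ℓ
A ⊗ B = record
  { Carrier = A.Carrier × B.Carrier
  ; _≈_ = λ { (a , b) (a' , b') → A._≈_ a a' × B._≈_ b b' }
  ; isEquivalence = record
      { refl = A'.refl , B'.refl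
      ; sym = λ { (p , q) → A'.sym p , B'.sym q }
      ; trans = λ { (p , q) (p' , q') → A'.trans p p' , B'.trans q q' } }
  ; _∧_ = λ { (a , b) (a' , b') → A._∧_ a a' , B._∧_ b b' }
  ; _∨_ = λ { (a , b) (a' , b') → A._∨_ a a' , B._∨_ b b' }
  ; ¬_ = λ { (a , b) → A.¬_ a , B.¬_ b }
  ; J₂ = λ { (a , b) → A.J₂ a , B.J₂ b }
  ; zero = A.zero , B.zero
  ; one = A.one , B.one
  ; ∧-cong = λ { (p , q) (p' , q') → A.∧-cong p p' , B.∧-cong q q' }
  ; ∨-cong = λ { (p , q) (p' , q') → A.∨-cong p p' , B.∨-cong q q' }
  ; ¬-cong = λ { (p , q) → A.¬-cong p , B.¬-cong q }
  ; J₂-cong = λ { (p , q) → A.J₂-cong p , B.J₂-cong q }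
  }
  where
    module A = Alg A
    module B = Alg B
    module A' = IsEquivalence A.isEquivalence
    module B' = IsEquivalence B.isEquivalence

record _≅_ {c ℓ c' ℓ'} (A : Alg c ℓ) (B : Alg c' ℓ') : Set (c ⊔ ℓ ⊔ c' ⊔ ℓ') where
  private
    module A = Alg A
    module B = Alg B
  field
    to   : A.Carrier → B.Carrier
    from : B.Carrier → A.Carrier
    to-cong   : ∀ {x y} → A._≈_ x y → B._≈_ (to x) (to y)
    from-cong : ∀ {x y} → B._≈_ x y → A._≈_ (from x) (from y)
    to-∧ : ∀ x y → B._≈_ (to (A._∧_ x y)) (B._∧_ (to x) (to y))
    to-∨ : ∀ x y → B._≈_ (to (A._∨_ x y)) (B._∨_ (to x) (to y))
    to-¬ : ∀ x → B._≈_ (to (A.¬_ x)) (B.¬_ (to x))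
    to-J₂ : ∀ x → B._≈_ (to (A.J₂ x)) (B.J₂ (to x))
    to-0 : B._≈_ (to A.zero) B.zero
    to-1 : B._≈_ (to A.one) B.one
    to-from : ∀ y → B._≈_ (to (from y)) y
    from-to : ∀ x → A._≈_ (from (to x)) x

InProd : ∀ {c ℓ} → Alg c ℓ → Set (lsuc (c ⊔ ℓ))
InProd {c} {ℓ} A =
  Σ (Alg c ℓ) λ A₁ → Σ (Alg c ℓ) λ A₂ → InBA A₁ × InSL A₂ × (A ≅ (A₁ ⊗ A₂))

{-# OPTIONS --safe #-}
-- In every A ∈ BA ∨ SL the kernels θ₁ of J₂ and θ₂ of x ↦ x ∧ 0 are complementary factor
-- congruences, and (a , b) ↦ J₂ a ∨ (b ∧ 0) inverts x ↦ (x , x).  Every identity this needs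
-- holds either in WK^e or in BA and SL separately.  A/θ₁ ∈ BA because J₂ s ≈ J₂ t holds in
-- all of SL, so it holds in A as soon as s ≈ t holds in BA; dually A/θ₂ ∈ SL because
-- s ∧ 0 ≈ t ∧ 0 holds in all of BA.  Conversely, a product of a BA and an SL algebra
-- satisfies every identity common to BA and SL, and identities transfer along isomorphisms.
module Submission where

open import Defs
open import Level using (Level; _⊔_)
open import Data.Nat using (ℕ; suc)
open import Data.Product using (_×_; _,_; proj₁; proj₂)
open import Function using (_∘_)
open import Relation.Binary.Bundles using (Setoid)
open import Relation.Binary.Core using (Rel; _Preserves_⟶_; _Preserves₂_⟶_⟶_)
import Relation.Binary.Construct.On as On
open import Relation.Binary.PropositionalEquality as ≡ using (_≡_)
import Relation.Binary.Reasoning.Setoid as SetoidReasoning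

v₀ v₁ : Term
v₀ = var 0
v₁ = var 1

⟨_,_⟩ : ∀ {a} {X : Set a} → X → X → ℕ → X
⟨ x , y ⟩ 0       = x
⟨ x , y ⟩ (suc _) = y

setoid : ∀ {c ℓ} → Alg c ℓ → Setoid c ℓ
setoid A = record { isEquivalence = Alg.isEquivalence A }

∧₃𝟎-∧₃ : ∀ a b → (a ∧₃ b) ∧₃ 𝟎 ≡ (a ∧₃ 𝟎) ∧₃ (b ∧₃ 𝟎)
∧₃𝟎-∧₃ ½ _ = ≡.refl
∧₃𝟎-∧₃ 𝟎 𝟎 = ≡.refl
∧₃𝟎-∧₃ 𝟎 ½ = ≡.refl
∧₃𝟎-∧₃ 𝟎 𝟏 = ≡.refl
∧₃𝟎-∧₃ 𝟏 𝟎 = ≡.refl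
∧₃𝟎-∧₃ 𝟏 ½ = ≡.refl
∧₃𝟎-∧₃ 𝟏 𝟏 = ≡.refl

∧₃𝟎-∨₃ : ∀ a b → (a ∨₃ b) ∧₃ 𝟎 ≡ (a ∧₃ 𝟎) ∧₃ (b ∧₃ 𝟎)
∧₃𝟎-∨₃ ½ _ = ≡.refl
∧₃𝟎-∨₃ 𝟎 𝟎 = ≡.refl
∧₃𝟎-∨₃ 𝟎 ½ = ≡.refl
∧₃𝟎-∨₃ 𝟎 𝟏 = ≡.refl
∧₃𝟎-∨₃ 𝟏 𝟎 = ≡.refl
∧₃𝟎-∨₃ 𝟏 ½ = ≡.refl
∧₃𝟎-∨₃ 𝟏 𝟏 = ≡.refl

∧₃𝟎-¬₃ : ∀ a → ¬₃ a ∧₃ 𝟎 ≡ a ∧₃ 𝟎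
∧₃𝟎-¬₃ 𝟎 = ≡.refl
∧₃𝟎-¬₃ ½ = ≡.refl
∧₃𝟎-¬₃ 𝟏 = ≡.refl

∧₃𝟎-J₂₃ : ∀ a → J₂₃ a ∧₃ 𝟎 ≡ 𝟎
∧₃𝟎-J₂₃ 𝟎 = ≡.refl
∧₃𝟎-J₂₃ ½ = ≡.refl
∧₃𝟎-J₂₃ 𝟏 = ≡.refl

∧₃𝟎-glue : ∀ a b → (J₂₃ a ∨₃ (b ∧₃ 𝟎)) ∧₃ 𝟎 ≡ b ∧₃ 𝟎
∧₃𝟎-glue 𝟎 𝟎 = ≡.refl
∧₃𝟎-glue 𝟎 ½ = ≡.refl
∧₃𝟎-glue 𝟎 𝟏 = ≡.refl
∧₃𝟎-glue ½ 𝟎 = ≡.refl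
∧₃𝟎-glue ½ ½ = ≡.refl
∧₃𝟎-glue ½ 𝟏 = ≡.refl
∧₃𝟎-glue 𝟏 𝟎 = ≡.refl
∧₃𝟎-glue 𝟏 ½ = ≡.refl
∧₃𝟎-glue 𝟏 𝟏 = ≡.refl

glue-diag₃ : ∀ a → J₂₃ a ∨₃ (a ∧₃ 𝟎) ≡ a
glue-diag₃ 𝟎 = ≡.refl
glue-diag₃ ½ = ≡.refl
glue-diag₃ 𝟏 = ≡.refl

module _ {c ℓ} {A B : Alg c ℓ} where

  ⟦⟧-⊗ : ∀ s (ρ : ℕ → Alg.Carrier (A ⊗ B)) →
         ⟦_⟧ (A ⊗ B) s ρ ≡ (⟦_⟧ A s (proj₁ ∘ ρ) , ⟦_⟧ B s (proj₂ ∘ ρ))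
  ⟦⟧-⊗ (var i)  ρ = ≡.refl
  ⟦⟧-⊗ (s ∧ₜ t) ρ = ≡.cong₂ (Alg._∧_ (A ⊗ B)) (⟦⟧-⊗ s ρ) (⟦⟧-⊗ t ρ)
  ⟦⟧-⊗ (s ∨ₜ t) ρ = ≡.cong₂ (Alg._∨_ (A ⊗ B)) (⟦⟧-⊗ s ρ) (⟦⟧-⊗ t ρ)
  ⟦⟧-⊗ (¬ₜ s)   ρ = ≡.cong (Alg.¬_ (A ⊗ B)) (⟦⟧-⊗ s ρ)
  ⟦⟧-⊗ (J₂ₜ s)  ρ = ≡.cong (Alg.J₂ (A ⊗ B)) (⟦⟧-⊗ s ρ)
  ⟦⟧-⊗ 0ₜ       ρ = ≡.refl
  ⟦⟧-⊗ 1ₜ       ρ = ≡.refl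

  Sat-⊗ : ∀ s t → Sat A s t → Sat B s t → Sat (A ⊗ B) s t
  Sat-⊗ s t A⊨s≈t B⊨s≈t ρ
    rewrite ⟦⟧-⊗ s ρ | ⟦⟧-⊗ t ρ = A⊨s≈t (proj₁ ∘ ρ) , B⊨s≈t (proj₂ ∘ ρ)

module _ {c ℓ c' ℓ'} {A : Alg c ℓ} {B : Alg c' ℓ'} (A≅B : A ≅ B) where
  private
    module A = Alg A
    module B = Alg B
    module AE = Setoid (setoid A)
    module BE = Setoid (setoid B)
  open _≅_ A≅B

  to-⟦⟧ : ∀ s ρ → B._≈_ (to (⟦_⟧ A s ρ)) (⟦_⟧ B s (to ∘ ρ))
  to-⟦⟧ (var i)  ρ = BE.refl
  to-⟦⟧ (s ∧ₜ t) ρ = BE.trans (to-∧ _ _) (B.∧-cong (to-⟦⟧ s ρ) (to-⟦⟧ t ρ))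
  to-⟦⟧ (s ∨ₜ t) ρ = BE.trans (to-∨ _ _) (B.∨-cong (to-⟦⟧ s ρ) (to-⟦⟧ t ρ))
  to-⟦⟧ (¬ₜ s)   ρ = BE.trans (to-¬ _) (B.¬-cong (to-⟦⟧ s ρ))
  to-⟦⟧ (J₂ₜ s)  ρ = BE.trans (to-J₂ _) (B.J₂-cong (to-⟦⟧ s ρ))
  to-⟦⟧ 0ₜ       ρ = to-0
  to-⟦⟧ 1ₜ       ρ = to-1

  Sat-≅ : ∀ s t → Sat B s t → Sat A s t
  Sat-≅ s t B⊨s≈t ρ = begin
    ⟦_⟧ A s ρ                    ≈⟨ AE.sym (from-to _) ⟩
    from (to (⟦_⟧ A s ρ))        ≈⟨ from-cong (to-⟦⟧ s ρ) ⟩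
    from (⟦_⟧ B s (to ∘ ρ))      ≈⟨ from-cong (B⊨s≈t (to ∘ ρ)) ⟩
    from (⟦_⟧ B t (to ∘ ρ))      ≈⟨ from-cong (BE.sym (to-⟦⟧ t ρ)) ⟩
    from (to (⟦_⟧ A t ρ))        ≈⟨ from-to _ ⟩
    ⟦_⟧ A t ρ                    ∎
    where open SetoidReasoning (setoid A)

InProd⇒InJoin : ∀ {c ℓ} {A : Alg c ℓ} → InProd A → InJoin A
InProd⇒InJoin (A₁ , A₂ , A₁∈BA , A₂∈SL , A≅A₁⊗A₂) s t BA⊨s≈t SL⊨s≈t =
  Sat-≅ A≅A₁⊗A₂ s t (Sat-⊗ {A = A₁} {B = A₂} s t (BA⊨s≈t A₁ A₁∈BA) (SL⊨s≈t A₂ A₂∈SL))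

module _ {c ℓ} (A : Alg c ℓ) where
  open Alg A

  ker : (Carrier → Carrier) → Rel Carrier ℓ
  ker f x y = f x ≈ f y

  record IsCongruentKernel (f : Carrier → Carrier) : Set (c ⊔ ℓ) where
    field
      f-cong  : f Preserves _≈_ ⟶ _≈_
      ∧-cong  : _∧_ Preserves₂ (ker f) ⟶ (ker f) ⟶ (ker f)
      ∨-cong  : _∨_ Preserves₂ (ker f) ⟶ (ker f) ⟶ (ker f)
      ¬-cong  : ¬_ Preserves (ker f) ⟶ (ker f)
      J₂-cong : J₂ Preserves (ker f) ⟶ (ker f)

module _ {c ℓ} (A : Alg c ℓ) (f : Alg.Carrier A → Alg.Carrier A) where
  open Alg A
  open Setoid (setoid A) using (sym; trans)

  kernel-respects₁ : ∀ (op h : Carrier → Carrier) →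
                     h Preserves _≈_ ⟶ _≈_ → (∀ x → f (op x) ≈ h (f x)) →
                     op Preserves (ker A f) ⟶ (ker A f)
  kernel-respects₁ op h h-cong factors {x} {x'} p =
    trans (factors x) (trans (h-cong p) (sym (factors x')))

  kernel-respects₂ : ∀ (op h : Carrier → Carrier → Carrier) →
                     h Preserves₂ _≈_ ⟶ _≈_ ⟶ _≈_ → (∀ x y → f (op x y) ≈ h (f x) (f y)) →
                     op Preserves₂ (ker A f) ⟶ (ker A f) ⟶ (ker A f)
  kernel-respects₂ op h h-cong factors {x} {x'} {y} {y'} p q =
    trans (factors x y) (trans (h-cong p q) (sym (factors x' y')))

module _ {c ℓ} {A : Alg c ℓ} {f : Alg.Carrier A → Alg.Carrier A} where
  open Alg A

  quotient : IsCongruentKernel A f → Alg c ℓ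
  quotient θ = record
    { Carrier = Carrier
    ; _≈_ = ker A f
    ; isEquivalence = On.isEquivalence f isEquivalence
    ; _∧_ = _∧_ ; _∨_ = _∨_ ; ¬_ = ¬_ ; J₂ = J₂ ; zero = zero ; one = one
    ; ∧-cong = IsCongruentKernel.∧-cong θ
    ; ∨-cong = IsCongruentKernel.∨-cong θ
    ; ¬-cong = IsCongruentKernel.¬-cong θ
    ; J₂-cong = IsCongruentKernel.J₂-cong θ
    }

  ⟦⟧-quotient : ∀ (θ : IsCongruentKernel A f) s ρ → ⟦_⟧ (quotient θ) s ρ ≡ ⟦_⟧ A s ρ
  ⟦⟧-quotient θ (var i)  ρ = ≡.refl
  ⟦⟧-quotient θ (s ∧ₜ t) ρ = ≡.cong₂ _∧_ (⟦⟧-quotient θ s ρ) (⟦⟧-quotient θ t ρ)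
  ⟦⟧-quotient θ (s ∨ₜ t) ρ = ≡.cong₂ _∨_ (⟦⟧-quotient θ s ρ) (⟦⟧-quotient θ t ρ)
  ⟦⟧-quotient θ (¬ₜ s)   ρ = ≡.cong ¬_ (⟦⟧-quotient θ s ρ)
  ⟦⟧-quotient θ (J₂ₜ s)  ρ = ≡.cong J₂ (⟦⟧-quotient θ s ρ)
  ⟦⟧-quotient θ 0ₜ       ρ = ≡.refl
  ⟦⟧-quotient θ 1ₜ       ρ = ≡.refl

  Sat-quotient : ∀ (θ : IsCongruentKernel A f) s t →
                 (∀ ρ → f (⟦_⟧ A s ρ) ≈ f (⟦_⟧ A t ρ)) → Sat (quotient θ) s t
  Sat-quotient θ s t A⊨fs≈ft ρ
    rewrite ⟦⟧-quotient θ s ρ | ⟦⟧-quotient θ t ρ = A⊨fs≈ft ρ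

-- glue witnesses θ ∘ φ = ∇, and glue x x ≈ x (with glue-cong) gives θ ∩ φ = Δ.
module _ {c ℓ} {A : Alg c ℓ} {f g : Alg.Carrier A → Alg.Carrier A}
         (θ : IsCongruentKernel A f) (φ : IsCongruentKernel A g) where
  open Alg A
  open Setoid (setoid A) using (refl)

  ≅-quotient-⊗ : (glue : Carrier → Carrier → Carrier) →
                 glue Preserves₂ (ker A f) ⟶ (ker A g) ⟶ _≈_ →
                 (∀ a b → f (glue a b) ≈ f a) →
                 (∀ a b → g (glue a b) ≈ g b) →
                 (∀ x → glue x x ≈ x) →
                 A ≅ (quotient θ ⊗ quotient φ)
  ≅-quotient-⊗ glue glue-cong f-glue g-glue glue-diag = record
    { to = λ x → x , x
    ; from = λ { (a , b) → glue a b }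
    ; to-cong = λ x≈y → f-cong x≈y , g-cong x≈y
    ; from-cong = λ { (p , q) → glue-cong p q }
    ; to-∧ = λ _ _ → refl , refl
    ; to-∨ = λ _ _ → refl , refl
    ; to-¬ = λ _ → refl , refl
    ; to-J₂ = λ _ → refl , refl
    ; to-0 = refl , refl
    ; to-1 = refl , refl
    ; to-from = λ { (a , b) → f-glue a b , g-glue a b }
    ; from-to = glue-diag
    }
    where
      open IsCongruentKernel θ using (f-cong)
      open IsCongruentKernel φ renaming (f-cong to g-cong)

module _ {c ℓ} (B : Alg c ℓ) where
  open Alg B
  open Setoid (setoid B) using (refl; sym; trans)

  InBA⇒x≈J₂x : InBA B → ∀ x → x ≈ J₂ x
  InBA⇒x≈J₂x (_ , B⊨J₂x≈x) x = sym (B⊨J₂x≈x (λ _ → x))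

  InBA⇒x∧0≈0 : InBA B → ∀ x → (x ∧ zero) ≈ zero
  InBA⇒x∧0≈0 B∈BA@(B∈V , _) x =
    trans (∧-cong (InBA⇒x≈J₂x B∈BA x) refl)
          (B∈V (J₂ₜ v₀ ∧ₜ 0ₜ) 0ₜ (λ ρ → ∧₃𝟎-J₂₃ (ρ 0)) (λ _ → x))

  InBA⇒J₂x∨y∧0≈x : InBA B → ∀ x y → (J₂ x ∨ (y ∧ zero)) ≈ x
  InBA⇒J₂x∨y∧0≈x B∈BA@(B∈V , _) x y =
    trans (∨-cong refl (trans (InBA⇒x∧0≈0 B∈BA y) (sym (InBA⇒x∧0≈0 B∈BA x))))
          (B∈V (J₂ₜ v₀ ∨ₜ (v₀ ∧ₜ 0ₜ)) v₀ (λ ρ → glue-diag₃ (ρ 0)) (λ _ → x))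

  InBA⇒Sat-∧0 : InBA B → ∀ s t → Sat B (s ∧ₜ 0ₜ) (t ∧ₜ 0ₜ)
  InBA⇒Sat-∧0 B∈BA s t ρ =
    trans (InBA⇒x∧0≈0 B∈BA _) (sym (InBA⇒x∧0≈0 B∈BA _))

  InSL⇒Sat-J₂ : InSL B → ∀ s t → Sat B (J₂ₜ s) (J₂ₜ t)
  InSL⇒Sat-J₂ (_ , B⊨J₂x≈1) s t ρ =
    trans (B⊨J₂x≈1 (λ _ → ⟦_⟧ B s ρ)) (sym (B⊨J₂x≈1 (λ _ → ⟦_⟧ B t ρ)))

module _ {c ℓ} {A : Alg c ℓ} (A∈BA∨SL : InJoin A) where
  open Alg A
  open Setoid (setoid A) using (refl)

  InJoin⇒SatWK : ∀ s t → SatWK s t → Sat A s t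
  InJoin⇒SatWK s t WK⊨s≈t =
    A∈BA∨SL s t (λ _ (B∈V , _) → B∈V s t WK⊨s≈t) (λ _ (B∈V , _) → B∈V s t WK⊨s≈t)

  InJoin⇒Sat-J₂ : ∀ s t → (∀ B → InBA B → Sat B s t) → Sat A (J₂ₜ s) (J₂ₜ t)
  InJoin⇒Sat-J₂ s t BA⊨s≈t = A∈BA∨SL (J₂ₜ s) (J₂ₜ t)
    (λ B B∈BA ρ → Alg.J₂-cong B (BA⊨s≈t B B∈BA ρ))
    (λ B B∈SL → InSL⇒Sat-J₂ B B∈SL s t)

  InJoin⇒Sat-∧0 : ∀ s t → (∀ B → InSL B → Sat B s t) → Sat A (s ∧ₜ 0ₜ) (t ∧ₜ 0ₜ)
  InJoin⇒Sat-∧0 s t SL⊨s≈t = A∈BA∨SL (s ∧ₜ 0ₜ) (t ∧ₜ 0ₜ)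
    (λ B B∈BA → InBA⇒Sat-∧0 B B∈BA s t)
    (λ B B∈SL ρ → Alg.∧-cong B (SL⊨s≈t B B∈SL ρ) (Setoid.refl (setoid B)))

  glue : Carrier → Carrier → Carrier
  glue a b = J₂ a ∨ (b ∧ zero)

  J₂-J₂ : ∀ x → J₂ (J₂ x) ≈ J₂ x
  J₂-J₂ x = InJoin⇒Sat-J₂ (J₂ₜ v₀) v₀ (λ _ → proj₂) (λ _ → x)

  J₂-∧ : ∀ x y → J₂ (x ∧ y) ≈ J₂ (J₂ x ∧ J₂ y)
  J₂-∧ x y = InJoin⇒Sat-J₂ (v₀ ∧ₜ v₁) (J₂ₜ v₀ ∧ₜ J₂ₜ v₁)
    (λ B B∈BA _ → Alg.∧-cong B (InBA⇒x≈J₂x B B∈BA _) (InBA⇒x≈J₂x B B∈BA _)) ⟨ x , y ⟩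

  J₂-∨ : ∀ x y → J₂ (x ∨ y) ≈ J₂ (J₂ x ∨ J₂ y)
  J₂-∨ x y = InJoin⇒Sat-J₂ (v₀ ∨ₜ v₁) (J₂ₜ v₀ ∨ₜ J₂ₜ v₁)
    (λ B B∈BA _ → Alg.∨-cong B (InBA⇒x≈J₂x B B∈BA _) (InBA⇒x≈J₂x B B∈BA _)) ⟨ x , y ⟩

  J₂-¬ : ∀ x → J₂ (¬ x) ≈ J₂ (¬ J₂ x)
  J₂-¬ x = InJoin⇒Sat-J₂ (¬ₜ v₀) (¬ₜ J₂ₜ v₀)
    (λ B B∈BA _ → Alg.¬-cong B (InBA⇒x≈J₂x B B∈BA _)) (λ _ → x)

  J₂-glue : ∀ a b → J₂ (glue a b) ≈ J₂ a
  J₂-glue a b = InJoin⇒Sat-J₂ (J₂ₜ v₀ ∨ₜ (v₁ ∧ₜ 0ₜ)) v₀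
    (λ B B∈BA ρ → InBA⇒J₂x∨y∧0≈x B B∈BA (ρ 0) (ρ 1)) ⟨ a , b ⟩

  ∧0-∧ : ∀ x y → ((x ∧ y) ∧ zero) ≈ ((x ∧ zero) ∧ (y ∧ zero))
  ∧0-∧ x y = InJoin⇒SatWK ((v₀ ∧ₜ v₁) ∧ₜ 0ₜ) ((v₀ ∧ₜ 0ₜ) ∧ₜ (v₁ ∧ₜ 0ₜ))
    (λ ρ → ∧₃𝟎-∧₃ (ρ 0) (ρ 1)) ⟨ x , y ⟩

  ∧0-∨ : ∀ x y → ((x ∨ y) ∧ zero) ≈ ((x ∧ zero) ∧ (y ∧ zero))
  ∧0-∨ x y = InJoin⇒SatWK ((v₀ ∨ₜ v₁) ∧ₜ 0ₜ) ((v₀ ∧ₜ 0ₜ) ∧ₜ (v₁ ∧ₜ 0ₜ))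
    (λ ρ → ∧₃𝟎-∨₃ (ρ 0) (ρ 1)) ⟨ x , y ⟩

  ∧0-¬ : ∀ x → ((¬ x) ∧ zero) ≈ (x ∧ zero)
  ∧0-¬ x = InJoin⇒SatWK ((¬ₜ v₀) ∧ₜ 0ₜ) (v₀ ∧ₜ 0ₜ) (λ ρ → ∧₃𝟎-¬₃ (ρ 0)) (λ _ → x)

  ∧0-J₂ : ∀ x → (J₂ x ∧ zero) ≈ zero
  ∧0-J₂ x = InJoin⇒SatWK (J₂ₜ v₀ ∧ₜ 0ₜ) 0ₜ (λ ρ → ∧₃𝟎-J₂₃ (ρ 0)) (λ _ → x)

  ∧0-glue : ∀ a b → (glue a b ∧ zero) ≈ (b ∧ zero)
  ∧0-glue a b = InJoin⇒SatWK ((J₂ₜ v₀ ∨ₜ (v₁ ∧ₜ 0ₜ)) ∧ₜ 0ₜ) (v₁ ∧ₜ 0ₜ)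
    (λ ρ → ∧₃𝟎-glue (ρ 0) (ρ 1)) ⟨ a , b ⟩

  glue-diag : ∀ x → glue x x ≈ x
  glue-diag x = InJoin⇒SatWK (J₂ₜ v₀ ∨ₜ (v₀ ∧ₜ 0ₜ)) v₀ (λ ρ → glue-diag₃ (ρ 0)) (λ _ → x)

  J₂-kernel : IsCongruentKernel A J₂
  J₂-kernel = record
    { f-cong  = J₂-cong
    ; ∧-cong  = kernel-respects₂ A J₂ _∧_ (λ a b → J₂ (a ∧ b)) (λ p q → J₂-cong (∧-cong p q)) J₂-∧
    ; ∨-cong  = kernel-respects₂ A J₂ _∨_ (λ a b → J₂ (a ∨ b)) (λ p q → J₂-cong (∨-cong p q)) J₂-∨
    ; ¬-cong  = kernel-respects₁ A J₂ ¬_ (λ a → J₂ (¬ a)) (λ p → J₂-cong (¬-cong p)) J₂-¬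
    ; J₂-cong = kernel-respects₁ A J₂ J₂ (λ a → a) (λ p → p) J₂-J₂
    }

  ∧0-kernel : IsCongruentKernel A (_∧ zero)
  ∧0-kernel = record
    { f-cong  = λ p → ∧-cong p refl
    ; ∧-cong  = kernel-respects₂ A (_∧ zero) _∧_ _∧_ ∧-cong ∧0-∧
    ; ∨-cong  = kernel-respects₂ A (_∧ zero) _∨_ _∧_ ∧-cong ∧0-∨
    ; ¬-cong  = kernel-respects₁ A (_∧ zero) ¬_ (λ a → a) (λ p → p) ∧0-¬
    ; J₂-cong = kernel-respects₁ A (_∧ zero) J₂ (λ _ → zero) (λ _ → refl) ∧0-J₂
    }

  quotient-J₂-∈BA : InBA (quotient J₂-kernel)
  quotient-J₂-∈BA = (λ s t WK⊨s≈t → BA⇒quotient s t (λ B B∈BA → proj₁ B∈BA s t WK⊨s≈t))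
                  , BA⇒quotient (J₂ₜ v₀) v₀ (λ _ → proj₂)
    where
      BA⇒quotient : ∀ s t → (∀ B → InBA B → Sat B s t) → Sat (quotient J₂-kernel) s t
      BA⇒quotient s t BA⊨s≈t = Sat-quotient J₂-kernel s t (InJoin⇒Sat-J₂ s t BA⊨s≈t)

  quotient-∧0-∈SL : InSL (quotient ∧0-kernel)
  quotient-∧0-∈SL = (λ s t WK⊨s≈t → SL⇒quotient s t (λ B B∈SL → proj₁ B∈SL s t WK⊨s≈t))
                  , SL⇒quotient (J₂ₜ v₀) 1ₜ (λ _ → proj₂)
    where
      SL⇒quotient : ∀ s t → (∀ B → InSL B → Sat B s t) → Sat (quotient ∧0-kernel) s t
      SL⇒quotient s t SL⊨s≈t = Sat-quotient ∧0-kernel s t (InJoin⇒Sat-∧0 s t SL⊨s≈t)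

  InJoin⇒InProd : InProd A
  InJoin⇒InProd =
      quotient J₂-kernel , quotient ∧0-kernel , quotient-J₂-∈BA , quotient-∧0-∈SL
    , ≅-quotient-⊗ J₂-kernel ∧0-kernel glue ∨-cong J₂-glue ∧0-glue glue-diag

corollary4p11 : ∀ {c ℓ : Level} (A : Alg c ℓ) →
    (InJoin A → InProd A) × (InProd A → InJoin A)
corollary4p11 A = InJoin⇒InProd , InProd⇒InJoin
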